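{- $E_\infty = \varprojlim E_n$ has infinite index in $\mathrm{Aut}(T_\infty)=\varprojlim \mathrm{Aut}(T_n)$.
   Context: $T_n$ is the regular ternary rooted tree with $n$ levels: vertices at level $i$ are sequences $(\ell_1,\dots,\ell_i)$ with $\ell_j\in\{1,2,3\}$, and $(\ell_1,\dots,\ell_i)$ is joined to $(\ell_1,\dots,\ell_{i+1})$; $T_\infty=\bigcup_n T_n$. $\mathrm{Aut}(T_n)$ is identified with $\mathrm{Aut}(T_{n-1})\wr\mathrm{Aut}(T_1)$: $((a_1,a_2,a_3),b)$ sends $(i,\ell_2,\dots,\ell_k)$ to $(b(i),a_i(\ell_2,\dots,\ell_k))$. The inverse limits are taken with respect to the restriction maps $\mathrm{Aut}(T_n)\to\mathrm{Aut}(T_m)$ ($m\le n$), which map $E_n$ into $E_m$. $\mathrm{sgn}_2(\sigma)$ is the sign of the permutation induced by $\sigma$ on the 9 vertices of level $2$. Define $E_1=\mathrm{Aut}(T_1)\cong\mathfrak S_3$ and, for $n\ge2$, $E_n=\{\sigma=((a_1,a_2,a_3),b)\in\mathrm{Aut}(T_n): a_1,a_2,a_3\in E_{n-1},\ \mathrm{sgn}_2(\sigma)=1\}$. -}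

module Defs where

open import Data.Nat using (ℕ; zero; suc; _%_)
open import Data.Fin using (Fin; combine; remQuot) renaming (zero to f0; suc to fs)
open import Data.Fin.Properties using (_<?_)
open import Data.Fin.Permutation using (Permutation′; _⟨$⟩ʳ_)
open import Data.Vec using (Vec; []; _∷_)
open import Data.List using (List; length; filter; cartesianProduct; allFin)
open import Data.Product using (Σ; _×_; _,_; proj₁; proj₂)
open import Data.Unit using (⊤; tt)
open import Relation.Nullary.Decidable using (_×-dec_)
open import Relation.Binary.PropositionalEquality using (_≡_)

Vertex : ℕ → Set
Vertex k = Vec (Fin 3) k

-- Aut(T_n) via the wreath recursion Aut(T_n) = Aut(T_{n-1}) ≀ S_3; Aut(T_0) trivial.
Aut : ℕ → Set
Aut zero    = ⊤
Aut (suc n) = (Aut n × Aut n × Aut n) × Permutation′ 3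

pick : {A : Set} → A × A × A → Fin 3 → A
pick (a , _ , _) f0           = a
pick (_ , b , _) (fs f0)      = b
pick (_ , _ , c) (fs (fs f0)) = c

act : {n : ℕ} → Aut n → Vertex n → Vertex n
act {zero}  _       []      = []
act {suc n} (a , b) (i ∷ w) = (b ⟨$⟩ʳ i) ∷ act (pick a i) w

restrict : {n : ℕ} → Aut (suc n) → Aut n
restrict {zero}  _                  = tt
restrict {suc n} ((a₁ , a₂ , a₃) , b) = ((restrict a₁ , restrict a₂ , restrict a₃) , b)

-- equality of automorphisms of T_n (determined by the action on level n)
_≈_ : {n : ℕ} → Aut n → Aut n → Set
_≈_ {n} σ τ = (v : Vertex n) → act σ v ≡ act τ v

res2 : (n : ℕ) → Aut (suc (suc n)) → Aut 2
res2 zero    σ = σ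
res2 (suc n) σ = res2 n (restrict σ)

inversions : {m : ℕ} → (Fin m → Fin m) → ℕ
inversions {m} f =
  length (filter (λ p → (proj₁ p <? proj₂ p) ×-dec (f (proj₂ p) <? f (proj₁ p)))
                 (cartesianProduct (allFin m) (allFin m)))

dec9 : Fin 9 → Vertex 2
dec9 k with remQuot {3} 3 k
... | (i , j) = i ∷ j ∷ []

enc9 : Vertex 2 → Fin 9
enc9 (i ∷ j ∷ []) = combine {3} {3} i j

level2perm : (n : ℕ) → Aut (suc (suc n)) → Fin 9 → Fin 9
level2perm n σ k = enc9 (act (res2 n σ) (dec9 k))

Sgn2Plus : (n : ℕ) → Aut (suc (suc n)) → Set
Sgn2Plus n σ = inversions (level2perm n σ) % 2 ≡ 0

-- membership in E_n (n ≥ 1); E_0 is taken to be all of the trivial group Aut(T_0)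
InE : (n : ℕ) → Aut n → Set
InE zero          _ = ⊤
InE (suc zero)    _ = ⊤
InE (suc (suc n)) ((a₁ , a₂ , a₃) , b) =
  InE (suc n) a₁ × InE (suc n) a₂ × InE (suc n) a₃ × Sgn2Plus n ((a₁ , a₂ , a₃) , b)

record Aut∞ : Set where
  field
    at     : (n : ℕ) → Aut n
    compat : (n : ℕ) → restrict (at (suc n)) ≈ at n
open Aut∞ public

InE∞ : Aut∞ → Set
InE∞ σ = (n : ℕ) → InE n (at σ n)

SameCoset : Aut∞ → Aut∞ → Set
SameCoset σ τ = Σ Aut∞ λ e → InE∞ e ×
  ((n : ℕ) (v : Vertex n) → act (at τ n) v ≡ act (at σ n) (act (at e n) v))

module Submission where

-- Let t_d ∈ Aut(T_∞) be the automorphism that swaps the first two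
-- children of the vertex 0^d = (1,…,1) (d letters) and fixes everything
-- else.  Below 0^d it acts like the root transposition t on T_2, which
-- permutes the 9 vertices of level 2 by three disjoint transpositions, so
-- sgn_2(t) = -1 and no element of E agrees with t on T_2.  Since E is closed
-- under taking sections (the automorphism induced on the subtree below a
-- vertex), no element of E_{d+2} acts below 0^d like t.
--
-- If a + 2 ≤ b, then on T_{a+2} the automorphism t_b is trivial and t_a is
-- an involution, so an element e with t_b = t_a e (or t_a = t_b e) agrees
-- with t_a on T_{a+2}; by the above e ∉ E_∞.  Hence t_0, t_2, t_4, … lie in
-- pairwise distinct cosets of E_∞, which is the corollary.

open import Defs
open import Data.Nat using (ℕ; zero; suc; _+_; _*_; _≤_; _<_; z≤n; s≤s; _%_)
open import Data.Fin using (Fin; toℕ) renaming (zero to f0; suc to fs)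
open import Data.Fin.Properties using (_<?_; <-cmp)
open import Data.Fin.Permutation using (Permutation′; id; transpose)
open import Data.Vec using ([]; _∷_; _++_)
open import Data.Vec.Properties using (++-injectiveʳ)
open import Data.List using (length; cartesianProduct; allFin)
open import Data.List.Properties using (filter-≐)
open import Data.Product using (Σ; ∃; _×_; _,_; proj₁; proj₂)
open import Data.Unit using (tt)
open import Relation.Nullary using (¬_)
open import Relation.Nullary.Decidable using (_×-dec_)
open import Relation.Unary using (Decidable)
import Data.Fin as Fin
open import Relation.Binary.Definitions using (tri<; tri≈; tri>)
open import Relation.Binary.PropositionalEquality

idAut : (n : ℕ) → Aut n
idAut zero    = tt
idAut (suc n) = (idAut n , idAut n , idAut n) , id

pick-const : {A : Set} (a : A) (i : Fin 3) → pick (a , a , a) i ≡ a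
pick-const a f0           = refl
pick-const a (fs f0)      = refl
pick-const a (fs (fs f0)) = refl

act-id : (n : ℕ) (v : Vertex n) → act (idAut n) v ≡ v
act-id zero    []      = refl
act-id (suc n) (i ∷ w) rewrite pick-const (idAut n) i = cong (i ∷_) (act-id n w)

act-id-twice : (n : ℕ) (v : Vertex n) → act (idAut n) (act (idAut n) v) ≡ v
act-id-twice n v = trans (act-id n (act (idAut n) v)) (act-id n v)

restrict-id : (n : ℕ) → restrict (idAut (suc n)) ≡ idAut n
restrict-id zero    = refl
restrict-id (suc n) = cong (λ a → (a , a , a) , id) (restrict-id n)

-- The section of x at a vertex u of level d: the automorphism that x induces
-- from the subtree below u onto the subtree below x(u).
section : {d m : ℕ} → Vertex d → Aut (d + m) → Aut m
section []      x       = x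
section (i ∷ u) (a , _) = section u (pick a i)

act-section : {d m : ℕ} (u : Vertex d) (x : Aut (d + m)) (w : Vertex m) →
  ∃ λ u′ → act x (u ++ w) ≡ u′ ++ act (section u x) w
act-section []      x       w = [] , refl
act-section (i ∷ u) (a , b) w with act-section u (pick a i) w
... | u′ , eq = _ , cong (_ ∷_) eq

inE-child : (n : ℕ) (x : Aut (suc n)) (i : Fin 3) →
  InE (suc n) x → InE n (pick (proj₁ x) i)
inE-child zero    x                   i            _             = tt
inE-child (suc n) ((a₁ , a₂ , a₃) , b) f0           (h , _)       = h
inE-child (suc n) ((a₁ , a₂ , a₃) , b) (fs f0)      (_ , h , _)   = h
inE-child (suc n) ((a₁ , a₂ , a₃) , b) (fs (fs f0)) (_ , _ , h , _) = h

inE-section : {d m : ℕ} (u : Vertex d) (x : Aut (d + m)) →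
  InE (d + m) x → InE m (section u x)
inE-section         []      x       h = h
inE-section {suc d} (i ∷ u) (a , b) h = inE-section u (pick a i) (inE-child (d + _) (a , b) i h)

inversions-cong : {m : ℕ} (f g : Fin m → Fin m) → (∀ k → f k ≡ g k) →
  inversions f ≡ inversions g
inversions-cong {m} f g f≗g = cong length (filter-≐ (inverted f) (inverted g)
  ((λ {p} (lt , inv) → lt , subst₂ _<_ (cong toℕ (f≗g (proj₂ p))) (cong toℕ (f≗g (proj₁ p))) inv)
  , (λ {p} (lt , inv) → lt , subst₂ _<_ (cong toℕ (sym (f≗g (proj₂ p)))) (cong toℕ (sym (f≗g (proj₁ p)))) inv))
  (cartesianProduct (allFin m) (allFin m)))
  where
  inverted : (h : Fin m → Fin m) →
    Decidable (λ (p : Fin m × Fin m) → proj₁ p Fin.< proj₂ p × h (proj₂ p) Fin.< h (proj₁ p))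
  inverted h p = (proj₁ p <? proj₂ p) ×-dec (h (proj₂ p) <? h (proj₁ p))

swap₁₂ : Permutation′ 3
swap₁₂ = transpose f0 (fs f0)

-- The root transposition t of T_2; on level 2 it is a product of three
-- disjoint transpositions, with 9 inversions.  (It is t_0 below.)
t : Aut 2
t = (idAut 1 , idAut 1 , idAut 1) , swap₁₂

inversions-t : inversions (level2perm 0 t) ≡ 9
inversions-t = refl

t∉E₂ : (y : Aut 2) → InE 2 y → ¬ (y ≈ t)
t∉E₂ ((a₁ , a₂ , a₃) , b) (_ , _ , _ , even) y≈t
  with trans (sym (cong (_% 2) (inversions-cong _ _ (λ k → cong enc9 (y≈t (dec9 k)))))) even
... | ()

not-t-below : {d : ℕ} (u : Vertex d) (x : Aut (d + 2)) → InE (d + 2) x →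
  ¬ ((w : Vertex 2) → act x (u ++ w) ≡ u ++ act t w)
not-t-below u x x∈E acts-like-t =
  t∉E₂ (section u x) (inE-section u x x∈E) λ w →
    let u′ , eq = act-section u x w
    in ++-injectiveʳ u′ u (trans (sym eq) (acts-like-t w))

-- swapAt d n is the restriction to T_n of t_d, the automorphism that swaps
-- the first two children of 0^d.
swapAt : ℕ → (n : ℕ) → Aut n
swapAt d       zero    = tt
swapAt zero    (suc n) = (idAut n , idAut n , idAut n) , swap₁₂
swapAt (suc d) (suc n) = (swapAt d n , idAut n , idAut n) , id

restrict-swapAt : (d n : ℕ) → restrict (swapAt d (suc n)) ≡ swapAt d n
restrict-swapAt zero    zero    = refl
restrict-swapAt zero    (suc n) = cong (λ a → (a , a , a) , swap₁₂) (restrict-id n)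
restrict-swapAt (suc d) zero    = refl
restrict-swapAt (suc d) (suc n) =
  cong₂ (λ a b → (a , b , b) , id) (restrict-swapAt d n) (restrict-id n)

t∞ : ℕ → Aut∞
at     (t∞ d) n   = swapAt d n
compat (t∞ d) n v = cong (λ x → act x v) (restrict-swapAt d n)

swapAt-trivial : (d n : ℕ) → n ≤ d → (v : Vertex n) → act (swapAt d n) v ≡ v
swapAt-trivial d       zero    _         []                = refl
swapAt-trivial (suc d) (suc n) (s≤s n≤d) (f0 ∷ w)          = cong (f0 ∷_) (swapAt-trivial d n n≤d w)
swapAt-trivial (suc d) (suc n) _         (fs f0 ∷ w)       = cong (fs f0 ∷_) (act-id n w)
swapAt-trivial (suc d) (suc n) _         (fs (fs f0) ∷ w)  = cong (fs (fs f0) ∷_) (act-id n w)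

swapAt-involutive : (d n : ℕ) (v : Vertex n) → act (swapAt d n) (act (swapAt d n) v) ≡ v
swapAt-involutive d       zero    []               = refl
swapAt-involutive zero    (suc n) (f0 ∷ w)         = cong (f0 ∷_) (act-id-twice n w)
swapAt-involutive zero    (suc n) (fs f0 ∷ w)      = cong (fs f0 ∷_) (act-id-twice n w)
swapAt-involutive zero    (suc n) (fs (fs f0) ∷ w) = cong (fs (fs f0) ∷_) (act-id-twice n w)
swapAt-involutive (suc d) (suc n) (f0 ∷ w)         = cong (f0 ∷_) (swapAt-involutive d n w)
swapAt-involutive (suc d) (suc n) (fs f0 ∷ w)      = cong (fs f0 ∷_) (act-id-twice n w)
swapAt-involutive (suc d) (suc n) (fs (fs f0) ∷ w) = cong (fs (fs f0) ∷_) (act-id-twice n w)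

zeros : (d : ℕ) → Vertex d
zeros zero    = []
zeros (suc d) = f0 ∷ zeros d

swapAt-below-zeros : (d : ℕ) {m : ℕ} (w : Vertex m) →
  act (swapAt d (d + m)) (zeros d ++ w) ≡ zeros d ++ act (swapAt 0 m) w
swapAt-below-zeros zero    w = refl
swapAt-below-zeros (suc d) w = cong (f0 ∷_) (swapAt-below-zeros d w)

-- If a + 2 ≤ b then t_b E_∞ ≠ t_a E_∞: an e with t_b = t_a e agrees with
-- t_a⁻¹ t_b = t_a on T_{a+2}, contradicting not-t-below.
t∞-apart : (a b : ℕ) → a + 2 ≤ b → ¬ SameCoset (t∞ a) (t∞ b)
t∞-apart a b a+2≤b (e , e∈E , tb≡tae) =
  not-t-below (zeros a) (at e (a + 2)) (e∈E (a + 2)) λ w → let v = zeros a ++ w in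
  begin
    act (at e (a + 2)) v
  ≡⟨ swapAt-involutive a (a + 2) _ ⟨
    act (swapAt a (a + 2)) (act (swapAt a (a + 2)) (act (at e (a + 2)) v))
  ≡⟨ cong (act (swapAt a (a + 2))) (tb≡tae (a + 2) v) ⟨
    act (swapAt a (a + 2)) (act (swapAt b (a + 2)) v)
  ≡⟨ cong (act (swapAt a (a + 2))) (swapAt-trivial b (a + 2) a+2≤b v) ⟩
    act (swapAt a (a + 2)) v
  ≡⟨ swapAt-below-zeros a w ⟩
    zeros a ++ act t w
  ∎
  where open ≡-Reasoning

-- Symmetrically t_a E_∞ ≠ t_b E_∞: an e with t_a = t_b e agrees with t_a
-- on T_{a+2} because t_b is trivial there.
t∞-apart′ : (a b : ℕ) → a + 2 ≤ b → ¬ SameCoset (t∞ b) (t∞ a)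
t∞-apart′ a b a+2≤b (e , e∈E , ta≡tbe) =
  not-t-below (zeros a) (at e (a + 2)) (e∈E (a + 2)) λ w → let v = zeros a ++ w in
  begin
    act (at e (a + 2)) v
  ≡⟨ swapAt-trivial b (a + 2) a+2≤b _ ⟨
    act (swapAt b (a + 2)) (act (at e (a + 2)) v)
  ≡⟨ ta≡tbe (a + 2) v ⟨
    act (swapAt a (a + 2)) v
  ≡⟨ swapAt-below-zeros a w ⟩
    zeros a ++ act t w
  ∎
  where open ≡-Reasoning

double : ℕ → ℕ
double p = p * 2

double-spaced : (p q : ℕ) → p < q → double p + 2 ≤ double q
double-spaced zero    (suc q) _       = s≤s (s≤s z≤n)
double-spaced (suc p) (suc q) (s≤s p<q) = s≤s (s≤s (double-spaced p q p<q))

corollary2p5 : (k : ℕ) → Σ (Fin k → Aut∞) λ σ →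
    (i j : Fin k) → i ≢ j → ¬ SameCoset (σ i) (σ j)
corollary2p5 k = (λ i → t∞ (double (toℕ i))) , apart
  where
  apart : (i j : Fin k) → i ≢ j → ¬ SameCoset (t∞ (double (toℕ i))) (t∞ (double (toℕ j)))
  apart i j i≢j with <-cmp i j
  ... | tri< i<j _ _ = t∞-apart  _ _ (double-spaced _ _ i<j)
  ... | tri≈ _ i≡j _ = λ _ → i≢j i≡j
  ... | tri> _ _ j<i = t∞-apart′ _ _ (double-spaced _ _ j<i)
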